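{- If $n$ is odd, then for every $\ell\in\mathbb{N}$ (with $\ell\ge 2$), \[\max(n,\ell)=\binom{n}{2}-\left\lfloor\frac{n}{2}\right\rfloor.\] Moreover, $\overline{M_n}$ is the unique $N$-AW graph of maximum size on $n$ vertices.
   Context: All graphs are finite and simple; labels lie in $\mathbb{Z}_\ell$. In the neighborhood Lights Out game on a graph $G$, each vertex carries a label in $\mathbb{Z}_\ell$; toggling a vertex $v$ adds $1$ (mod $\ell$) to the label of every vertex of the closed neighborhood $N[v]$; the game is won when all labels are $0$. $G$ is $N$-AW if the game can be won from every initial labeling. $\max(n,\ell)$ is the maximum number of edges of an $N$-AW graph on $n$ vertices. $M_n$ denotes a perfect matching on $n$ vertices when $n$ is even and a near-perfect matching on $n$ vertices ($\lfloor n/2\rfloor$ disjoint edges plus one isolated vertex) when $n$ is odd; $\overline{M_n}$ is its complement. -}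

module Defs where

open import Data.Nat using (ℕ; zero; suc; _+_; _%_; _/_; _<ᵇ_; _≡ᵇ_; NonZero)
open import Data.Bool using (Bool; true; false; _∧_; _∨_; not; if_then_else_)
open import Data.Fin using (Fin; toℕ)
open import Data.List using (List; map; allFin)
open import Data.Nat.ListAction using (sum)
open import Data.Product using (Σ; ∃; _×_; _,_)
open import Relation.Binary.PropositionalEquality using (_≡_; refl; cong; cong₂)
open import Function.Bundles using (_↔_; Inverse)

record Graph (n : ℕ) : Set where
  field
    adj    : Fin n → Fin n → Bool
    sym    : ∀ i j → adj i j ≡ adj j i
    irrefl : ∀ i → adj i i ≡ false
open Graph public

Σv : {n : ℕ} → (Fin n → ℕ) → ℕ
Σv {n} f = sum (map f (allFin n))

_=ᵥ_ : {n : ℕ} → Fin n → Fin n → Bool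
i =ᵥ j = toℕ i ≡ᵇ toℕ j

edges : {n : ℕ} → Graph n → ℕ
edges G = Σv (λ i → Σv (λ j → if (toℕ i <ᵇ toℕ j) ∧ adj G i j then 1 else 0))

inN[_] : {n : ℕ} → Graph n → Fin n → Fin n → Bool
inN[ G ] u v = (u =ᵥ v) ∨ adj G u v

-- Neighbourhood Lights Out over ℤ_ℓ: toggling vertex v  t v  times
-- (order of toggles is irrelevant) changes the label of u by
-- Σ_{v ∈ N[u]} t v.  The game is won when every label is 0 mod ℓ.
Wins : {n : ℕ} (ℓ : ℕ) .{{_ : NonZero ℓ}} → Graph n → (Fin n → Fin ℓ) → (Fin n → ℕ) → Set
Wins ℓ G c t = ∀ u → (toℕ (c u) + Σv (λ v → if inN[ G ] u v then t v else 0)) % ℓ ≡ 0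

N-AW : {n : ℕ} (ℓ : ℕ) .{{_ : NonZero ℓ}} → Graph n → Set
N-AW ℓ G = ∀ (c : _ → Fin ℓ) → ∃ λ t → Wins ℓ G c t

-- M_n: (near-)perfect matching pairing 2k with 2k+1; when n is odd the
-- vertex n-1 is isolated.  Its complement:
coMadj : {n : ℕ} → Fin n → Fin n → Bool
coMadj i j = not (i =ᵥ j) ∧ not ((toℕ i / 2) ≡ᵇ (toℕ j / 2))

≡ᵇ-comm : ∀ m k → (m ≡ᵇ k) ≡ (k ≡ᵇ m)
≡ᵇ-comm zero zero = refl
≡ᵇ-comm zero (suc k) = refl
≡ᵇ-comm (suc m) zero = refl
≡ᵇ-comm (suc m) (suc k) = ≡ᵇ-comm m k

≡ᵇ-refl : ∀ m → (m ≡ᵇ m) ≡ true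
≡ᵇ-refl zero = refl
≡ᵇ-refl (suc m) = ≡ᵇ-refl m

coM : (n : ℕ) → Graph n
coM n = record
  { adj = coMadj
  ; sym = λ i j → cong₂ (λ a b → not a ∧ not b) (≡ᵇ-comm (toℕ i) (toℕ j)) (≡ᵇ-comm (toℕ i / 2) (toℕ j / 2))
  ; irrefl = λ i → cong (λ a → not a ∧ not ((toℕ i / 2) ≡ᵇ (toℕ i / 2))) (≡ᵇ-refl (toℕ i))
  }


_≅_ : {n : ℕ} → Graph n → Graph n → Set
_≅_ {n} G H = Σ (Fin n ↔ Fin n) λ σ → ∀ i j → adj G i j ≡ adj H (Inverse.to σ i) (Inverse.to σ j)

-- Write H for the complement of G.  Two distinct vertices isolated in H are universal in G, hence
-- closed twins, and no sequence of toggles can make their labels differ; so when G is N-AW, H has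
-- at most one isolated vertex.  Then n ≤ 1 + Σ deg_H = 1 + 2 e(H), i.e. e(H) ≥ ⌊n/2⌋ for odd n,
-- which is the edge bound.  In the equality case every vertex of H has degree at most 1 and exactly
-- one is isolated, so H is a near-perfect matching; any two near-perfect matchings are conjugate
-- (normalise the pairs {2k, 2k+1} one at a time by transpositions), whence G ≅ co M_n.  Conversely
-- co M_n is N-AW by an explicit toggle count, and it has the extremal size since e(M_n) = ⌊n/2⌋.

module Submission where

open import Defs
open import Data.Nat using (ℕ; _≤_; _∸_; _/_; _%_; NonZero)
open import Data.Nat.Combinatorics using (_C_)
open import Data.Product using (_×_)
open import Relation.Binary.PropositionalEquality using (_≡_)

open import Data.Bool using (Bool; T; true; false; _∧_; not; if_then_else_)
import Data.Bool.Properties as Bool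
open import Data.Fin using (Fin; toℕ; fromℕ; fromℕ<; _≟_) renaming (zero to fzero; suc to fsuc)
open import Data.Fin.Permutation using (Permutation′; permutation; _⟨$⟩ʳ_; _∘ₚ_)
import Data.Fin.Permutation as Perm
open import Data.Fin.Permutation.Components using (transpose)
open import Data.Fin.Properties using (toℕ-injective; toℕ-fromℕ; toℕ-fromℕ<; toℕ<n; any?)
open import Data.List using (tabulate)
open import Data.List.Properties using (map-tabulate)
open import Data.Nat using (zero; suc; pred; _+_; _*_; _<_; _<ᵇ_; _≡ᵇ_; _<?_; _≤?_; ⌊_/2⌋; z≤n; s≤s)
open import Data.Nat.Combinatorics using (nC1≡n; nCk+nC[k+1]≡[n+1]C[k+1])
open import Data.Nat.Divisibility using (m%n≡0⇒n∣m)
open import Data.Nat.DivMod using (m≡m%n+[m/n]*n; m/n≡1+[m∸n]/n; m<n⇒m%n≡m; %-remove-+ʳ; m*n%n≡0)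
import Data.Nat.ListAction as List
open import Data.Nat.Properties hiding (_≟_)
open import Algebra.Properties.CommutativeMonoid.Sum +-0-commutativeMonoid
  using (sum; sum-cong-≗; ∑-distrib-+; ∑-comm)
open import Data.Nat.Tactic.RingSolver using (solve-∀)
open import Data.Product using (∃; _,_; proj₁; proj₂; map₂)
open import Data.Sum using (_⊎_; inj₁; inj₂)
open import Function using (_∘_; id)
open import Relation.Binary.PropositionalEquality
  using (_≢_; refl; trans; cong; cong₂; subst; subst₂; module ≡-Reasoning)
import Relation.Binary.PropositionalEquality as ≡
open import Relation.Nullary using (¬_; Dec; yes; no)
open import Relation.Nullary.Decidable using (dec-true; dec-false)
open import Relation.Nullary.Negation using (contradiction)

𝟙 : Bool → ℕ
𝟙 b = if b then 1 else 0

private variable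
  n : ℕ

≡ᵇ-true⇒≡ : ∀ {x y} → (x ≡ᵇ y) ≡ true → x ≡ y
≡ᵇ-true⇒≡ {x} {y} eq = ≡ᵇ⇒≡ x y (subst T (≡.sym eq) _)

≢⇒≡ᵇ-false : ∀ {x y} → x ≢ y → (x ≡ᵇ y) ≡ false
≢⇒≡ᵇ-false {x} {y} x≢y = Bool.¬-not (x≢y ∘ ≡ᵇ-true⇒≡)

=ᵥ-refl : (i : Fin n) → (i =ᵥ i) ≡ true
=ᵥ-refl i = ≡ᵇ-refl (toℕ i)

=ᵥ-sym : (i j : Fin n) → (i =ᵥ j) ≡ (j =ᵥ i)
=ᵥ-sym i j = ≡ᵇ-comm (toℕ i) (toℕ j)

=ᵥ⇒≡ : {i j : Fin n} → (i =ᵥ j) ≡ true → i ≡ j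
=ᵥ⇒≡ = toℕ-injective ∘ ≡ᵇ-true⇒≡

≢⇒=ᵥ-false : {i j : Fin n} → i ≢ j → (i =ᵥ j) ≡ false
≢⇒=ᵥ-false i≢j = ≢⇒≡ᵇ-false (i≢j ∘ toℕ-injective)

Σv≡sum : (f : Fin n → ℕ) → Σv f ≡ sum f
Σv≡sum f = trans (cong List.sum (map-tabulate id f)) (sum-tabulate f)
  where
  sum-tabulate : ∀ {k} (g : Fin k → ℕ) → List.sum (tabulate g) ≡ sum g
  sum-tabulate {zero}  g = refl
  sum-tabulate {suc k} g = cong (g fzero +_) (sum-tabulate (g ∘ fsuc))

Σv-cong : {f g : Fin n → ℕ} → (∀ i → f i ≡ g i) → Σv f ≡ Σv g
Σv-cong {f = f} {g} f≗g = trans (Σv≡sum f) (trans (sum-cong-≗ f≗g) (≡.sym (Σv≡sum g)))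

sum-zero : sum {n} (λ _ → 0) ≡ 0
sum-zero {zero}  = refl
sum-zero {suc n} = sum-zero {n}

sum-one : sum {n} (λ _ → 1) ≡ n
sum-one {zero}  = refl
sum-one {suc n} = cong suc (sum-one {n})

sum-mono-≤ : {f g : Fin n → ℕ} → (∀ i → f i ≤ g i) → sum f ≤ sum g
sum-mono-≤ {zero}  f≤g = z≤n
sum-mono-≤ {suc n} f≤g = +-mono-≤ (f≤g fzero) (sum-mono-≤ (f≤g ∘ fsuc))

sum-mono-≤-equality : {f g : Fin n → ℕ} → (∀ i → f i ≤ g i) → sum g ≤ sum f → ∀ i → f i ≡ g i
sum-mono-≤-equality {suc n} {f} {g} f≤g Σg≤Σf fzero = ≤-antisym (f≤g fzero)
  (+-cancelʳ-≤ _ _ _ (≤-trans (+-monoʳ-≤ (g fzero) (sum-mono-≤ (f≤g ∘ fsuc))) Σg≤Σf))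
sum-mono-≤-equality {suc n} {f} {g} f≤g Σg≤Σf (fsuc i) = sum-mono-≤-equality (f≤g ∘ fsuc)
  (+-cancelˡ-≤ (f fzero) _ _ (≤-trans (+-monoˡ-≤ (sum (g ∘ fsuc)) (f≤g fzero)) Σg≤Σf)) i

sum-≥-term : (f : Fin n → ℕ) (i : Fin n) → f i ≤ sum f
sum-≥-term f fzero    = m≤m+n _ _
sum-≥-term f (fsuc i) = ≤-trans (sum-≥-term (f ∘ fsuc) i) (m≤n+m _ _)

sum-point : (k : Fin n) (f : Fin n → ℕ) → sum (λ v → if v =ᵥ k then f v else 0) ≡ f k
sum-point {suc n} fzero    f = trans (cong (f fzero +_) (sum-zero {n})) (+-identityʳ (f fzero))
sum-point {suc n} (fsuc k) f = sum-point k (f ∘ fsuc)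

sum-split-at : (k : Fin n) (f : Fin n → ℕ) → sum f ≡ sum (λ v → if v =ᵥ k then 0 else f v) + f k
sum-split-at k f = begin
  sum f                        ≡⟨ sum-cong-≗ split ⟩
  sum (λ v → off v + on v)     ≡⟨ ∑-distrib-+ off on ⟩
  sum off + sum on             ≡⟨ cong (sum off +_) (sum-point k f) ⟩
  sum off + f k                ∎
  where
  open ≡-Reasoning
  off on : Fin _ → ℕ
  off v = if v =ᵥ k then 0 else f v
  on  v = if v =ᵥ k then f v else 0
  split : ∀ v → f v ≡ off v + on v
  split v with v =ᵥ k
  ... | true  = refl
  ... | false = ≡.sym (+-identityʳ (f v))

count : (Fin n → Bool) → ℕ
count p = sum (𝟙 ∘ p)

count-none : (p : Fin n → Bool) → (∀ i → p i ≡ false) → count p ≡ 0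
count-none {n} p none = trans (sum-cong-≗ (cong 𝟙 ∘ none)) (sum-zero {n})

count≡0⇒none : (p : Fin n → Bool) → count p ≡ 0 → ∀ i → p i ≡ false
count≡0⇒none p count≡0 i = 𝟙≤0 (≤-trans (sum-≥-term (𝟙 ∘ p) i) (≤-reflexive count≡0))
  where
  𝟙≤0 : ∀ {b} → 𝟙 b ≤ 0 → b ≡ false
  𝟙≤0 {false} _ = refl

∄⇒count≡0 : (p : Fin n → Bool) → ¬ (∃ λ i → p i ≡ true) → count p ≡ 0
∄⇒count≡0 p ∄ = count-none p (λ i → Bool.¬-not (λ pᵢ → ∄ (i , pᵢ)))

count≥1⇒∃ : (p : Fin n → Bool) → 1 ≤ count p → ∃ λ i → p i ≡ true
count≥1⇒∃ p 1≤count with any? (λ i → p i Bool.≟ true)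
... | yes witness = witness
... | no  ∄       = contradiction (≤-trans 1≤count (≤-reflexive (∄⇒count≡0 p ∄))) λ ()

unique⇒count≤1 : (p : Fin n → Bool) → (∀ {i j} → p i ≡ true → p j ≡ true → i ≡ j) → count p ≤ 1
unique⇒count≤1 p unique with any? (λ i → p i Bool.≟ true)
... | no  ∄        = ≤-trans (≤-reflexive (∄⇒count≡0 p ∄)) z≤n
... | yes (i , pᵢ) = begin
  count p        ≤⟨ sum-mono-≤ p≤[=i] ⟩
  count (_=ᵥ i)  ≡⟨ sum-point i (λ _ → 1) ⟩
  1              ∎
  where
  open ≤-Reasoning
  p≤[=i] : ∀ v → 𝟙 (p v) ≤ 𝟙 (v =ᵥ i)
  p≤[=i] v with p v in pᵥ
  ... | false = z≤n
  ... | true rewrite unique pᵥ pᵢ | =ᵥ-refl i = ≤-refl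

count≤1⇒unique : (p : Fin n → Bool) → count p ≤ 1 → ∀ {i j} → p i ≡ true → p j ≡ true → i ≡ j
count≤1⇒unique p count≤1 {i} {j} pᵢ pⱼ with i ≟ j
... | yes i≡j = i≡j
... | no  i≢j = contradiction (≤-trans two≤count count≤1) λ { (s≤s ()) }
  where
  two≤count : 2 ≤ count p
  two≤count = begin
    2                                                    ≡⟨ cong₂ (λ a b → 𝟙 a + 𝟙 b) pⱼ pᵢ ⟨
    𝟙 (p j) + 𝟙 (p i)                                    ≡⟨ cong (λ b → (if b then 0 else 𝟙 (p j)) + 𝟙 (p i)) j=i ⟨
    (if j =ᵥ i then 0 else 𝟙 (p j)) + 𝟙 (p i)            ≤⟨ +-monoˡ-≤ (𝟙 (p i)) (sum-≥-term _ j) ⟩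
    sum (λ v → if v =ᵥ i then 0 else 𝟙 (p v)) + 𝟙 (p i)  ≡⟨ sum-split-at i (𝟙 ∘ p) ⟨
    count p                                              ∎
    where
    open ≤-Reasoning
    j=i : (j =ᵥ i) ≡ false
    j=i = ≢⇒=ᵥ-false (i≢j ∘ ≡.sym)

private
  _≺_ : Fin n → Fin n → Bool
  i ≺ j = toℕ i <ᵇ toℕ j

pairs≡C2 : ∀ n → sum {n} (λ i → count (i ≺_)) ≡ n C 2
pairs≡C2 zero    = refl
pairs≡C2 (suc n) = begin
  sum {n} (λ _ → 1) + sum {n} (λ i → count (i ≺_))  ≡⟨ cong₂ _+_ (sum-one {n}) (pairs≡C2 n) ⟩
  n + n C 2                                         ≡⟨ cong (_+ n C 2) (nC1≡n n) ⟨
  n C 1 + n C 2                                     ≡⟨ nCk+nC[k+1]≡[n+1]C[k+1] n 1 ⟩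
  suc n C 2                                         ∎
  where open ≡-Reasoning

<ᵇ-connex : ∀ x y → x ≢ y → 𝟙 (x <ᵇ y) + 𝟙 (y <ᵇ x) ≡ 1
<ᵇ-connex zero    zero    x≢y = contradiction refl x≢y
<ᵇ-connex zero    (suc y) _   = refl
<ᵇ-connex (suc x) zero    _   = refl
<ᵇ-connex (suc x) (suc y) x≢y = <ᵇ-connex x y (x≢y ∘ cong suc)

double≡2* : ∀ x → x + x ≡ 2 * x
double≡2* x = cong (x +_) (≡.sym (+-identityʳ x))

double-cancel-≤ : ∀ {x y} → x + x ≤ y + y → x ≤ y
double-cancel-≤ {x} {y} le = *-cancelˡ-≤ 2 (subst₂ _≤_ (double≡2* x) (double≡2* y) le)

double-injective : ∀ {x y} → x + x ≡ y + y → x ≡ y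
double-injective {x} {y} eq = *-cancelˡ-≡ x y 2 (trans (≡.sym (double≡2* x)) (trans eq (double≡2* y)))

co : Graph n → Graph n
co G = record
  { adj    = λ i j → not (i =ᵥ j) ∧ not (adj G i j)
  ; sym    = λ i j → cong₂ (λ e a → not e ∧ not a) (=ᵥ-sym i j) (sym G i j)
  ; irrefl = λ i → cong (λ e → not e ∧ not (adj G i i)) (=ᵥ-refl i)
  }

adj⇒≢ : (G : Graph n) {i j : Fin n} → adj G i j ≡ true → i ≢ j
adj⇒≢ G {i} aᵢⱼ refl = contradiction (trans (≡.sym aᵢⱼ) (irrefl G i)) λ ()

inN≡not-co : (G : Graph n) (u x : Fin n) → inN[ G ] u x ≡ not (adj (co G) u x)
inN≡not-co G u x with u =ᵥ x
... | true  = refl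
... | false = ≡.sym (Bool.not-involutive (adj G u x))

adj≡via-co : (G : Graph n) (i j : Fin n) → adj G i j ≡ not (i =ᵥ j) ∧ not (adj (co G) i j)
adj≡via-co G i j with i =ᵥ j in i=j
... | true  = subst (λ k → adj G i k ≡ false) (=ᵥ⇒≡ i=j) (irrefl G i)
... | false = ≡.sym (Bool.not-involutive (adj G i j))

deg : Graph n → Fin n → ℕ
deg G i = count (adj G i)

edges≡sum : (G : Graph n) → edges G ≡ sum (λ i → sum (λ j → 𝟙 (i ≺ j ∧ adj G i j)))
edges≡sum {n} G = trans (Σv≡sum {n} _) (sum-cong-≗ {n} (λ i → Σv≡sum {n} _))

module _ (G : Graph n) where

  handshake : sum (deg G) ≡ edges G + edges G
  handshake = begin
    sum (deg G)                              ≡⟨ sum-cong-≗ (λ i → trans (sum-cong-≗ (split i)) (∑-distrib-+ (A i) (B i))) ⟩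
    sum (λ i → ΣA i + ΣB i)                  ≡⟨ ∑-distrib-+ ΣA ΣB ⟩
    sum ΣA + sum ΣB                          ≡⟨ cong (sum ΣA +_) (∑-comm B) ⟩
    sum ΣA + sum (λ j → sum (λ i → B i j))   ≡⟨ cong (sum ΣA +_) (sum-cong-≗ λ j → sum-cong-≗ λ i → B≡Aᵀ i j) ⟩
    sum ΣA + sum ΣA                          ≡⟨ cong₂ _+_ (edges≡sum G) (edges≡sum G) ⟨
    edges G + edges G                        ∎
    where
    open ≡-Reasoning
    A B : Fin n → Fin n → ℕ
    A i j = 𝟙 (i ≺ j ∧ adj G i j)
    B i j = 𝟙 (j ≺ i ∧ adj G i j)
    ΣA ΣB : Fin n → ℕ
    ΣA i = sum (A i)
    ΣB i = sum (B i)
    B≡Aᵀ : ∀ i j → B i j ≡ A j i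
    B≡Aᵀ i j = cong (λ a → 𝟙 (j ≺ i ∧ a)) (sym G i j)
    split : ∀ i j → 𝟙 (adj G i j) ≡ A i j + B i j
    split i j with adj G i j in aᵢⱼ
    ... | false rewrite Bool.∧-zeroʳ (i ≺ j) | Bool.∧-zeroʳ (j ≺ i) = refl
    ... | true  rewrite Bool.∧-identityʳ (i ≺ j) | Bool.∧-identityʳ (j ≺ i) =
      ≡.sym (<ᵇ-connex (toℕ i) (toℕ j) (adj⇒≢ G aᵢⱼ ∘ toℕ-injective))

  edges+edges-co : edges G + edges (co G) ≡ n C 2
  edges+edges-co = begin
    edges G + edges (co G)       ≡⟨ cong₂ _+_ (edges≡sum G) (edges≡sum (co G)) ⟩
    sum ΣA + sum ΣB              ≡⟨ ∑-distrib-+ ΣA ΣB ⟨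
    sum (λ i → ΣA i + ΣB i)      ≡⟨ sum-cong-≗ (λ i → trans (≡.sym (∑-distrib-+ (A i) (B i))) (sum-cong-≗ (split i))) ⟩
    sum {n} (λ i → count (i ≺_)) ≡⟨ pairs≡C2 n ⟩
    n C 2                        ∎
    where
    open ≡-Reasoning
    A B : Fin n → Fin n → ℕ
    A i j = 𝟙 (i ≺ j ∧ adj G i j)
    B i j = 𝟙 (i ≺ j ∧ adj (co G) i j)
    ΣA ΣB : Fin n → ℕ
    ΣA i = sum (A i)
    ΣB i = sum (B i)
    split : ∀ i j → A i j + B i j ≡ 𝟙 (i ≺ j)
    split i j with i ≺ j in i<j
    ... | false = refl
    ... | true  = exactly-one (adj G i j) (≢⇒=ᵥ-false {i = i} {j} (<⇒≢ i<j′ ∘ cong toℕ))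
      where
      i<j′ : toℕ i < toℕ j
      i<j′ = <ᵇ⇒< (toℕ i) (toℕ j) (subst T (≡.sym i<j) _)
      exactly-one : ∀ a {e} → e ≡ false → 𝟙 a + 𝟙 (not e ∧ not a) ≡ 1
      exactly-one true  refl = refl
      exactly-one false refl = refl

edges≡C2∸edges-co : (G : Graph n) → edges G ≡ n C 2 ∸ edges (co G)
edges≡C2∸edges-co G =
  trans (≡.sym (m+n∸n≡m (edges G) (edges (co G)))) (cong (_∸ edges (co G)) (edges+edges-co G))

edges-co≤C2 : (G : Graph n) → edges (co G) ≤ n C 2
edges-co≤C2 G = ≤-trans (m≤n+m (edges (co G)) (edges G)) (≤-reflexive (edges+edges-co G))

-- Closed twins

N-AW⇒twin-free : ∀ {ℓ} .{{_ : NonZero ℓ}} → 2 ≤ ℓ → (G : Graph n) → N-AW ℓ G →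
                 ∀ {u v} → (∀ x → inN[ G ] u x ≡ inN[ G ] v x) → u ≡ v
N-AW⇒twin-free {n} {ℓ} 2≤ℓ G aw {u} {v} twins with u ≟ v
... | yes u≡v = u≡v
... | no  u≢v = contradiction 1≡0 λ ()
  where
  one nil : Fin ℓ
  one = fromℕ< 2≤ℓ
  nil = fromℕ< (≤-trans (s≤s z≤n) 2≤ℓ)
  c : Fin n → Fin ℓ
  c x = if x =ᵥ u then one else nil
  t : Fin n → ℕ
  t = proj₁ (aw c)
  s sᵤ : ℕ
  s  = Σv (λ x → if inN[ G ] v x then t x else 0)
  sᵤ = Σv (λ x → if inN[ G ] u x then t x else 0)
  sᵤ≡s : sᵤ ≡ s
  sᵤ≡s = Σv-cong (λ x → cong (λ b → if b then t x else 0) (twins x))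
  cᵤ≡1 : toℕ (c u) ≡ 1
  cᵤ≡1 = trans (cong (λ b → toℕ (if b then one else nil)) (=ᵥ-refl u)) (toℕ-fromℕ< 2≤ℓ)
  cᵥ≡0 : toℕ (c v) ≡ 0
  cᵥ≡0 = trans (cong (λ b → toℕ (if b then one else nil)) (≢⇒=ᵥ-false (u≢v ∘ ≡.sym))) (toℕ-fromℕ< _)
  s%ℓ≡0 : s % ℓ ≡ 0
  s%ℓ≡0 = trans (cong (λ a → (a + s) % ℓ) (≡.sym cᵥ≡0)) (proj₂ (aw c) v)
  1≡0 : 1 ≡ 0
  1≡0 = begin
    1                       ≡⟨ m<n⇒m%n≡m 2≤ℓ ⟨
    1 % ℓ                   ≡⟨ %-remove-+ʳ 1 (m%n≡0⇒n∣m s ℓ s%ℓ≡0) ⟨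
    (1 + s) % ℓ             ≡⟨ cong₂ (λ a b → (a + b) % ℓ) cᵤ≡1 sᵤ≡s ⟨
    (toℕ (c u) + sᵤ) % ℓ    ≡⟨ proj₂ (aw c) u ⟩
    0                       ∎
    where open ≡-Reasoning

N-AW⇒co-isolated-unique : ∀ {ℓ} .{{_ : NonZero ℓ}} → 2 ≤ ℓ → (G : Graph n) → N-AW ℓ G →
                          ∀ {u v} → deg (co G) u ≡ 0 → deg (co G) v ≡ 0 → u ≡ v
N-AW⇒co-isolated-unique 2≤ℓ G aw u-isolated v-isolated =
  N-AW⇒twin-free 2≤ℓ G aw λ x → trans (universal u-isolated x) (≡.sym (universal v-isolated x))
  where
  universal : ∀ {u} → deg (co G) u ≡ 0 → ∀ x → inN[ G ] u x ≡ true
  universal {u} isolated x = trans (inN≡not-co G u x) (cong not (count≡0⇒none (adj (co G) u) isolated x))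

-- Near-perfect matchings and their complements

record NearPerfectMatching (n : ℕ) : Set where
  field
    mate         : Fin n → Fin n
    mate-mate    : ∀ i → mate (mate i) ≡ i
    centre       : Fin n
    mate-centre  : mate centre ≡ centre
    fixed⇒centre : ∀ i → mate i ≡ i → i ≡ centre

  mate-≢ : ∀ {u} → u ≢ centre → mate u ≢ u
  mate-≢ u≢w = u≢w ∘ fixed⇒centre _

  mate-≢-centre : ∀ {u} → u ≢ centre → mate u ≢ centre
  mate-≢-centre {u} u≢w eq = u≢w (trans (≡.sym (mate-mate u)) (trans (cong mate eq) mate-centre))

open NearPerfectMatching

IsMatchingGraph : NearPerfectMatching n → Graph n → Set
IsMatchingGraph {n} P H = ∀ (i j : Fin n) → adj H i j ≡ not (i =ᵥ j) ∧ (j =ᵥ mate P i)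

module _ (P : NearPerfectMatching n) where

  matching-adj-centre : ∀ x → not (centre P =ᵥ x) ∧ (x =ᵥ mate P (centre P)) ≡ false
  matching-adj-centre x rewrite mate-centre P | =ᵥ-sym x (centre P) = Bool.∧-inverseˡ (centre P =ᵥ x)

  matching-adj-off-centre : ∀ {u} → u ≢ centre P → ∀ x → not (u =ᵥ x) ∧ (x =ᵥ mate P u) ≡ (x =ᵥ mate P u)
  matching-adj-off-centre {u} u≢w x with x =ᵥ mate P u in x=u′
  ... | false = Bool.∧-zeroʳ _
  ... | true  rewrite ≢⇒=ᵥ-false {i = u} {x} (λ u≡x → mate-≢ P u≢w (≡.sym (trans u≡x (=ᵥ⇒≡ x=u′)))) = refl

module _ {P : NearPerfectMatching n} {H : Graph n} (H≡P : IsMatchingGraph P H) where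

  open ≡-Reasoning

  matching-deg : ∀ i → deg H i ≡ (if i =ᵥ centre P then 0 else 1)
  matching-deg i with i ≟ centre P
  ... | yes refl = begin
    deg H i                           ≡⟨ count-none (adj H i) (λ x → trans (H≡P i x) (matching-adj-centre P x)) ⟩
    0                                 ≡⟨ cong (λ b → if b then 0 else 1) (=ᵥ-refl i) ⟨
    (if i =ᵥ i then 0 else 1)         ∎
  ... | no  i≢w  = begin
    deg H i                           ≡⟨ sum-cong-≗ (λ x → cong 𝟙 (trans (H≡P i x) (matching-adj-off-centre P i≢w x))) ⟩
    count (_=ᵥ mate P i)              ≡⟨ sum-point (mate P i) (λ _ → 1) ⟩
    1                                 ≡⟨ cong (λ b → if b then 0 else 1) (≢⇒=ᵥ-false i≢w) ⟨
    (if i =ᵥ centre P then 0 else 1)  ∎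

  1+Σdeg-matching : 1 + sum (deg H) ≡ n
  1+Σdeg-matching = begin
    1 + sum (deg H)                                        ≡⟨ +-comm 1 _ ⟩
    sum (deg H) + 1                                        ≡⟨ cong (_+ 1) (sum-cong-≗ matching-deg) ⟩
    sum (λ i → if i =ᵥ centre P then 0 else 1) + 1         ≡⟨ sum-split-at (centre P) (λ _ → 1) ⟨
    sum {n} (λ _ → 1)                                      ≡⟨ sum-one ⟩
    n                                                      ∎

module _ (P : NearPerfectMatching n) (G : Graph n) (co-G≡P : IsMatchingGraph P (co G)) where

  inN-centre : ∀ x → inN[ G ] (centre P) x ≡ true
  inN-centre x = trans (inN≡not-co G _ x) (cong not (trans (co-G≡P _ x) (matching-adj-centre P x)))

  inN-off-centre : ∀ {u} → u ≢ centre P → ∀ x → inN[ G ] u x ≡ not (x =ᵥ mate P u)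
  inN-off-centre {u} u≢w x = trans (inN≡not-co G u x) (cong not (trans (co-G≡P u x) (matching-adj-off-centre P u≢w x)))

  -- N[centre] is every vertex and N[u] misses only mate u, so with T = Σ t the label of u
  -- becomes c u + T − t (mate u) and that of the centre c w + T.  Toggle every v ≠ w exactly
  -- c (mate v) + K times, R times in all; toggling w exactly (ℓ − 1) R + K times then gives
  -- T = ℓ R + K, and both labels vanish modulo ℓ once K = (ℓ − 1) c w.
  complement-of-matching-N-AW : ∀ ℓ .{{_ : NonZero ℓ}} → N-AW ℓ G
  complement-of-matching-N-AW ℓ c = t , wins
    where
    open ≡-Reasoning
    w : Fin n
    w = centre P
    lbl : Fin n → ℕ
    lbl = toℕ ∘ c
    l K R : ℕ
    l = pred ℓ
    K = l * lbl w
    R = sum (λ v → if v =ᵥ w then 0 else lbl (mate P v) + K)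
    t : Fin n → ℕ
    t v = if v =ᵥ w then l * R + K else lbl (mate P v) + K

    toggled : Fin n → ℕ
    toggled u = Σv (λ x → if inN[ G ] u x then t x else 0)

    total : sum t ≡ R * suc l + K
    total = begin
      sum t                                        ≡⟨ sum-split-at w t ⟩
      sum (λ v → if v =ᵥ w then 0 else t v) + t w  ≡⟨ cong₂ _+_ (sum-cong-≗ off-w) t-w ⟩
      R + (l * R + K)                              ≡⟨ rearrange R l K ⟩
      R * suc l + K                                ∎
      where
      rearrange : ∀ r k x → r + (k * r + x) ≡ r * suc k + x
      rearrange = solve-∀
      t-w : t w ≡ l * R + K
      t-w = cong (λ b → if b then l * R + K else lbl (mate P w) + K) (=ᵥ-refl w)
      off-w : ∀ v → (if v =ᵥ w then 0 else t v) ≡ (if v =ᵥ w then 0 else lbl (mate P v) + K)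
      off-w v with v =ᵥ w
      ... | true  = refl
      ... | false = refl

    toggled-centre : toggled w ≡ sum t
    toggled-centre = trans (Σv-cong (λ x → cong (λ b → if b then t x else 0) (inN-centre x))) (Σv≡sum t)

    toggled-off-centre : ∀ {u} → u ≢ w → toggled u + t (mate P u) ≡ sum t
    toggled-off-centre {u} u≢w =
      trans (cong (_+ t (mate P u)) (trans (Σv-cong off) (Σv≡sum t-off))) (≡.sym (sum-split-at (mate P u) t))
      where
      t-off : Fin n → ℕ
      t-off x = if x =ᵥ mate P u then 0 else t x
      off : ∀ x → (if inN[ G ] u x then t x else 0) ≡ t-off x
      off x rewrite inN-off-centre u≢w x with x =ᵥ mate P u
      ... | true  = refl
      ... | false = refl

    t-mate : ∀ {u} → u ≢ w → t (mate P u) ≡ lbl u + K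
    t-mate {u} u≢w rewrite ≢⇒=ᵥ-false (mate-≢-centre P u≢w) | mate-mate P u = refl

    multiple%ℓ : ∀ {a} x → a ≡ x * suc l → a % ℓ ≡ 0
    multiple%ℓ x refl = trans (cong (λ k → (x * k) % ℓ) (suc-pred ℓ)) (m*n%n≡0 x ℓ)

    wins : Wins ℓ G c t
    wins u with u ≟ w
    ... | yes refl = multiple%ℓ (R + lbl w) (begin
      lbl w + toggled w                ≡⟨ cong (lbl w +_) (trans toggled-centre total) ⟩
      lbl w + (R * suc l + l * lbl w)  ≡⟨ factor (lbl w) R l ⟩
      (R + lbl w) * suc l              ∎)
      where
      factor : ∀ a r k → a + (r * suc k + k * a) ≡ (r + a) * suc k
      factor = solve-∀
    ... | no  u≢w  = multiple%ℓ R (+-cancelʳ-≡ K _ _ (begin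
      lbl u + toggled u + K            ≡⟨ regroup (lbl u) (toggled u) K ⟩
      toggled u + (lbl u + K)          ≡⟨ cong (toggled u +_) (t-mate u≢w) ⟨
      toggled u + t (mate P u)         ≡⟨ toggled-off-centre u≢w ⟩
      sum t                            ≡⟨ total ⟩
      R * suc l + K                    ∎))
      where
      regroup : ∀ a s k → a + s + k ≡ s + (a + k)
      regroup = solve-∀

module _ (H : Graph n) (isolated-unique : ∀ {u v} → deg H u ≡ 0 → deg H v ≡ 0 → u ≡ v) where

  private
    isolated? : Fin n → Bool
    isolated? i = deg H i ≡ᵇ 0

    isolated-or-deg≥1 : ∀ i → 1 ≤ 𝟙 (isolated? i) + deg H i
    isolated-or-deg≥1 i with deg H i
    ... | zero  = s≤s z≤n
    ... | suc _ = s≤s z≤n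

    count-isolated≤1 : count isolated? ≤ 1
    count-isolated≤1 = unique⇒count≤1 isolated? λ u-iso v-iso → isolated-unique (≡ᵇ-true⇒≡ u-iso) (≡ᵇ-true⇒≡ v-iso)

    n≤count-isolated+Σdeg : n ≤ count isolated? + sum (deg H)
    n≤count-isolated+Σdeg = begin
      n                                            ≡⟨ sum-one ⟨
      sum {n} (λ _ → 1)                            ≤⟨ sum-mono-≤ isolated-or-deg≥1 ⟩
      sum (λ i → 𝟙 (isolated? i) + deg H i)        ≡⟨ ∑-distrib-+ (𝟙 ∘ isolated?) (deg H) ⟩
      count isolated? + sum (deg H)                ∎
      where open ≤-Reasoning

  n≤1+Σdeg : n ≤ 1 + sum (deg H)
  n≤1+Σdeg = ≤-trans n≤count-isolated+Σdeg (+-monoˡ-≤ _ count-isolated≤1)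

  n≡1+Σdeg⇒deg≤1×isolated : n ≡ 1 + sum (deg H) → (∀ i → deg H i ≤ 1) × ∃ λ w → deg H w ≡ 0
  n≡1+Σdeg⇒deg≤1×isolated n≡ = deg≤1 , map₂ ≡ᵇ-true⇒≡ (count≥1⇒∃ isolated? 1≤count-isolated)
    where
    tight : ∀ i → 1 ≡ 𝟙 (isolated? i) + deg H i
    tight = sum-mono-≤-equality isolated-or-deg≥1 (begin
      sum (λ i → 𝟙 (isolated? i) + deg H i)        ≡⟨ ∑-distrib-+ (𝟙 ∘ isolated?) (deg H) ⟩
      count isolated? + sum (deg H)                ≤⟨ +-monoˡ-≤ _ count-isolated≤1 ⟩
      1 + sum (deg H)                              ≡⟨ n≡ ⟨
      n                                            ≡⟨ sum-one ⟨
      sum {n} (λ _ → 1)                            ∎)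
      where open ≤-Reasoning
    deg≤1 : ∀ i → deg H i ≤ 1
    deg≤1 i = ≤-trans (m≤n+m (deg H i) _) (≤-reflexive (≡.sym (tight i)))
    1≤count-isolated : 1 ≤ count isolated?
    1≤count-isolated = +-cancelʳ-≤ (sum (deg H)) 1 _ (≤-trans (≤-reflexive (≡.sym n≡)) n≤count-isolated+Σdeg)

module _ (H : Graph n) (deg≤1 : ∀ i → deg H i ≤ 1) where

  mateOf : Fin n → Fin n
  mateOf i with any? (λ j → adj H i j Bool.≟ true)
  ... | yes (j , _) = j
  ... | no  _       = i

  mateOf-cases : ∀ i → (adj H i (mateOf i) ≡ true) ⊎ ((∀ j → adj H i j ≡ false) × mateOf i ≡ i)
  mateOf-cases i with any? (λ j → adj H i j Bool.≟ true)
  ... | yes (j , aᵢⱼ) = inj₁ aᵢⱼ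
  ... | no  ∄         = inj₂ ((λ j → Bool.¬-not (λ aᵢⱼ → ∄ (j , aᵢⱼ))) , refl)

  adj≡mateOf : ∀ i j → adj H i j ≡ not (i =ᵥ j) ∧ (j =ᵥ mateOf i)
  adj≡mateOf i j with mateOf-cases i
  ... | inj₂ (none , mate≡i) rewrite none j | mate≡i | =ᵥ-sym j i with i =ᵥ j
  ...   | true  = refl
  ...   | false = refl
  adj≡mateOf i j | inj₁ aᵢₘ with adj H i j in aᵢⱼ
  ... | true rewrite count≤1⇒unique (adj H i) (deg≤1 i) aᵢⱼ aᵢₘ
                   | ≢⇒=ᵥ-false (adj⇒≢ H aᵢₘ) | =ᵥ-refl (mateOf i) = refl
  ... | false with j =ᵥ mateOf i in j=m
  ...   | true  = contradiction (trans (≡.sym aᵢⱼ) (subst (λ k → adj H i k ≡ true) (≡.sym (=ᵥ⇒≡ j=m)) aᵢₘ)) λ ()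
  ...   | false = ≡.sym (Bool.∧-zeroʳ _)

  adj⇒≡mateOf : ∀ {i j} → adj H i j ≡ true → j ≡ mateOf i
  adj⇒≡mateOf {i} {j} aᵢⱼ = =ᵥ⇒≡ (∧-true-right (trans (≡.sym (adj≡mateOf i j)) aᵢⱼ))
    where
    ∧-true-right : ∀ {a b} → a ∧ b ≡ true → b ≡ true
    ∧-true-right {true} b≡true = b≡true

  mateOf-mateOf : ∀ i → mateOf (mateOf i) ≡ i
  mateOf-mateOf i with mateOf-cases i
  ... | inj₁ aᵢₘ          = ≡.sym (adj⇒≡mateOf (trans (sym H (mateOf i) i) aᵢₘ))
  ... | inj₂ (_ , mate≡i) = trans (cong mateOf mate≡i) mate≡i

  mateOf≡self⇒isolated : ∀ {i} → mateOf i ≡ i → deg H i ≡ 0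
  mateOf≡self⇒isolated {i} mate≡i = count-none (adj H i) λ j →
    trans (adj≡mateOf i j) (trans (cong (λ k → not (i =ᵥ j) ∧ (j =ᵥ k)) mate≡i)
                                  (trans (cong (λ b → not (i =ᵥ j) ∧ b) (=ᵥ-sym j i)) (Bool.∧-inverseˡ (i =ᵥ j))))

  isolated⇒mateOf≡self : ∀ {i} → deg H i ≡ 0 → mateOf i ≡ i
  isolated⇒mateOf≡self {i} isolated = ≡.sym (=ᵥ⇒≡ (Bool.not-injective (begin
    not (i =ᵥ mateOf i)                                ≡⟨ Bool.∧-identityʳ _ ⟨
    not (i =ᵥ mateOf i) ∧ true                         ≡⟨ cong (not (i =ᵥ mateOf i) ∧_) (=ᵥ-refl (mateOf i)) ⟨
    not (i =ᵥ mateOf i) ∧ (mateOf i =ᵥ mateOf i)       ≡⟨ adj≡mateOf i (mateOf i) ⟨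
    adj H i (mateOf i)                                 ≡⟨ count≡0⇒none (adj H i) isolated (mateOf i) ⟩
    false                                              ∎)))
    where open ≡-Reasoning

  matchingOf : (w : Fin n) → deg H w ≡ 0 → (∀ i → deg H i ≡ 0 → i ≡ w) → NearPerfectMatching n
  matchingOf w w-isolated isolated⇒w = record
    { mate         = mateOf
    ; mate-mate    = mateOf-mateOf
    ; centre       = w
    ; mate-centre  = isolated⇒mateOf≡self w-isolated
    ; fixed⇒centre = λ i → isolated⇒w i ∘ mateOf≡self⇒isolated
    }

-- Conjugacy of near-perfect matchings

transpose-≡ˡ : (i j : Fin n) → transpose i j i ≡ j
transpose-≡ˡ i j rewrite dec-true (i ≟ i) refl = refl

transpose-≡ʳ : (i j : Fin n) → transpose i j j ≡ i
transpose-≡ʳ i j with j ≟ i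
... | yes j≡i = j≡i
... | no  _   rewrite dec-true (j ≟ j) refl = refl

transpose-≢ : {i j k : Fin n} → k ≢ i → k ≢ j → transpose i j k ≡ k
transpose-≢ {i = i} {j} {k} k≢i k≢j rewrite dec-false (k ≟ i) k≢i | dec-false (k ≟ j) k≢j = refl

transpose-involutive : (i j k : Fin n) → transpose i j (transpose i j k) ≡ k
transpose-involutive i j k = by-cases (k ≟ i) (k ≟ j)
  where
  by-cases : ∀ {i j k : Fin n} → Dec (k ≡ i) → Dec (k ≡ j) → transpose i j (transpose i j k) ≡ k
  by-cases {j = j} {k = k} (yes refl) _ = trans (cong (transpose k j) (transpose-≡ˡ k j)) (transpose-≡ʳ k j)
  by-cases {i = i} {k = k} (no _) (yes refl) = trans (cong (transpose i k) (transpose-≡ʳ i k)) (transpose-≡ˡ i k)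
  by-cases {i = i} {j = j} (no k≢i) (no k≢j) = trans (cong (transpose i j) (transpose-≢ k≢i k≢j)) (transpose-≢ k≢i k≢j)

record _∼_ (P Q : NearPerfectMatching n) : Set where
  constructor conjugatedBy
  field
    σ      : Permutation′ n
    σ-mate : ∀ i → σ ⟨$⟩ʳ mate P i ≡ mate Q (σ ⟨$⟩ʳ i)

∼-refl : {P : NearPerfectMatching n} → P ∼ P
∼-refl = conjugatedBy Perm.id λ _ → refl

∼-trans : {P Q R : NearPerfectMatching n} → P ∼ Q → Q ∼ R → P ∼ R
∼-trans (conjugatedBy σ σP≡Qσ) (conjugatedBy τ τQ≡Rτ) =
  conjugatedBy (σ ∘ₚ τ) λ i → trans (cong (τ ⟨$⟩ʳ_) (σP≡Qσ i)) (τQ≡Rτ (σ ⟨$⟩ʳ i))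

∼-resp-mate : {P Q R : NearPerfectMatching n} → P ∼ Q → (∀ i → mate Q i ≡ mate R i) → P ∼ R
∼-resp-mate (conjugatedBy σ σP≡Qσ) Q≗R = conjugatedBy σ λ i → trans (σP≡Qσ i) (Q≗R (σ ⟨$⟩ʳ i))

conjugate : (s : Fin n → Fin n) → (∀ i → s (s i) ≡ i) → NearPerfectMatching n → NearPerfectMatching n
conjugate s s-s P = record
  { mate         = λ i → s (mate P (s i))
  ; mate-mate    = λ i → trans (cong (s ∘ mate P) (s-s _)) (trans (cong s (mate-mate P (s i))) (s-s i))
  ; centre       = s (centre P)
  ; mate-centre  = trans (cong (s ∘ mate P) (s-s _)) (cong s (mate-centre P))
  ; fixed⇒centre = λ i fixed → trans (≡.sym (s-s i))
      (cong s (fixed⇒centre P (s i) (trans (≡.sym (s-s _)) (cong s fixed))))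
  }

conjugate-∼ : (s : Fin n → Fin n) (s-s : ∀ i → s (s i) ≡ i) (P : NearPerfectMatching n) → P ∼ conjugate s s-s P
conjugate-∼ s s-s P = conjugatedBy (permutation s s s-s s-s) λ i → cong (s ∘ mate P) (≡.sym (s-s i))

swap : Fin n → Fin n → NearPerfectMatching n → NearPerfectMatching n
swap a b = conjugate (transpose a b) (transpose-involutive a b)

swap-∼ : (a b : Fin n) (P : NearPerfectMatching n) → P ∼ swap a b P
swap-∼ a b = conjugate-∼ (transpose a b) (transpose-involutive a b)

=ᵥ-permute : (σ : Permutation′ n) (i j : Fin n) → ((σ ⟨$⟩ʳ i) =ᵥ (σ ⟨$⟩ʳ j)) ≡ (i =ᵥ j)
=ᵥ-permute σ i j with i ≟ j
... | yes refl = trans (=ᵥ-refl (σ ⟨$⟩ʳ i)) (≡.sym (=ᵥ-refl i))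
... | no  i≢j  = trans (≢⇒=ᵥ-false (i≢j ∘ injective)) (≡.sym (≢⇒=ᵥ-false i≢j))
  where
  injective : σ ⟨$⟩ʳ i ≡ σ ⟨$⟩ʳ j → i ≡ j
  injective σi≡σj = trans (≡.sym (Perm.inverseˡ σ)) (trans (cong (σ Perm.⟨$⟩ˡ_) σi≡σj) (Perm.inverseˡ σ))

co-matching-∼⇒≅ : {P Q : NearPerfectMatching n} {G H : Graph n} →
                  IsMatchingGraph P (co G) → IsMatchingGraph Q (co H) → P ∼ Q → G ≅ H
co-matching-∼⇒≅ {P = P} {Q} {G} {H} co-G≡P co-H≡Q (conjugatedBy σ σ-mate) = σ , λ i j → begin
  adj G i j                                                      ≡⟨ adj≡via-co G i j ⟩
  not (i =ᵥ j) ∧ not (adj (co G) i j)                            ≡⟨ cong (λ a → not (i =ᵥ j) ∧ not a) (co-G≡P i j) ⟩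
  not (i =ᵥ j) ∧ not (not (i =ᵥ j) ∧ (j =ᵥ mate P i))            ≡⟨ cong₂ (λ e a → not e ∧ not (not e ∧ a)) (=ᵥ-permute σ i j) (=ᵥ-mate i j) ⟨
  not (π i =ᵥ π j) ∧ not (not (π i =ᵥ π j) ∧ (π j =ᵥ mate Q (π i))) ≡⟨ cong (λ a → not (π i =ᵥ π j) ∧ not a) (co-H≡Q (π i) (π j)) ⟨
  not (π i =ᵥ π j) ∧ not (adj (co H) (π i) (π j))                ≡⟨ adj≡via-co H (π i) (π j) ⟨
  adj H (π i) (π j)                                              ∎
  where
  open ≡-Reasoning
  π : Fin _ → Fin _
  π = σ ⟨$⟩ʳ_
  =ᵥ-mate : ∀ i j → (π j =ᵥ mate Q (π i)) ≡ (j =ᵥ mate P i)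
  =ᵥ-mate i j = trans (cong (π j =ᵥ_) (≡.sym (σ-mate i))) (=ᵥ-permute σ j (mate P i))

-- The standard near-perfect matching M_n

sibling : ℕ → ℕ
sibling zero          = 1
sibling (suc zero)    = 0
sibling (suc (suc x)) = suc (suc (sibling x))

sibling-involutive : ∀ x → sibling (sibling x) ≡ x
sibling-involutive zero          = refl
sibling-involutive (suc zero)    = refl
sibling-involutive (suc (suc x)) = cong (suc ∘ suc) (sibling-involutive x)

sibling-≢ : ∀ x → sibling x ≢ x
sibling-≢ (suc (suc x)) eq = sibling-≢ x (suc-injective (suc-injective eq))

sibling-double : ∀ k → sibling (k + k) ≡ suc (k + k)
sibling-double zero    = refl
sibling-double (suc k) rewrite +-suc k k = cong (suc ∘ suc) (sibling-double k)

sibling-< : ∀ k {x} → x < k + k → sibling x < k + k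
sibling-< (suc k) {zero}          _ rewrite +-suc k k = s≤s (s≤s z≤n)
sibling-< (suc k) {suc zero}      _ = s≤s z≤n
sibling-< (suc k) {suc (suc x)} x< rewrite +-suc k k = s≤s (s≤s (sibling-< k (≤-pred (≤-pred x<))))

StandardAt : NearPerfectMatching n → Fin n → Set
StandardAt P i = toℕ (mate P i) ≡ sibling (toℕ i)

StandardBelow : ℕ → NearPerfectMatching n → Set
StandardBelow {n} k P = ∀ (i : Fin n) → toℕ i < k + k → StandardAt P i

swap-StandardBelow : ∀ {k} {P : NearPerfectMatching n} {a b : Fin n} →
                     k + k ≤ toℕ a → k + k ≤ toℕ b → StandardBelow k P → StandardBelow k (swap a b P)
swap-StandardBelow {k = k} {P} {a} {b} 2k≤a 2k≤b std i i<2k = begin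
  toℕ (transpose a b (mate P (transpose a b i)))  ≡⟨ cong (λ j → toℕ (transpose a b (mate P j))) (fixed i<2k) ⟩
  toℕ (transpose a b (mate P i))                  ≡⟨ cong toℕ (fixed mate<2k) ⟩
  toℕ (mate P i)                                  ≡⟨ std i i<2k ⟩
  sibling (toℕ i)                                 ∎
  where
  open ≡-Reasoning
  mate<2k : toℕ (mate P i) < k + k
  mate<2k = subst (_< k + k) (≡.sym (std i i<2k)) (sibling-< k i<2k)
  below≢ : ∀ {j c} → toℕ j < k + k → k + k ≤ toℕ c → j ≢ c
  below≢ j<2k 2k≤c refl = <⇒≱ j<2k 2k≤c
  fixed : ∀ {j} → toℕ j < k + k → transpose a b j ≡ j
  fixed j<2k = transpose-≢ (below≢ j<2k 2k≤a) (below≢ j<2k 2k≤b)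

module _ {m k : ℕ} (k<m : k < m) where

  private
    2k<N : k + k < suc (m + m)
    2k<N = m<n⇒m<1+n (+-mono-< k<m k<m)

    2k+1<N : suc (k + k) < suc (m + m)
    2k+1<N = s≤s (+-mono-< k<m k<m)

    v v′ last : Fin (suc (m + m))
    v    = fromℕ< 2k<N
    v′   = fromℕ< 2k+1<N
    last = fromℕ (m + m)

    toℕ-v : toℕ v ≡ k + k
    toℕ-v = toℕ-fromℕ< 2k<N

    toℕ-v′ : toℕ v′ ≡ suc (k + k)
    toℕ-v′ = toℕ-fromℕ< 2k+1<N

    2k≤last : k + k ≤ toℕ last
    2k≤last = ≤-trans (+-mono-≤ (<⇒≤ k<m) (<⇒≤ k<m)) (≤-reflexive (≡.sym (toℕ-fromℕ (m + m))))

    v≢v′ : v ≢ v′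
    v≢v′ v≡v′ = 1+n≢n (trans (≡.sym toℕ-v′) (trans (cong toℕ (≡.sym v≡v′)) toℕ-v))

    v≢last : v ≢ last
    v≢last v≡last = <-irrefl (trans (≡.sym toℕ-v) (trans (cong toℕ v≡last) (toℕ-fromℕ (m + m)))) (+-mono-< k<m k<m)

  StandardBelow-suc : (P : NearPerfectMatching (suc (m + m))) → StandardBelow k P →
                      mate P v ≡ v′ → StandardBelow (suc k) P
  StandardBelow-suc P std P-v i i<2k+2 with m<1+n⇒m<n∨m≡n (subst (toℕ i <_) (+-suc (suc k) k) i<2k+2)
  ... | inj₂ i≡2k+1 = subst (StandardAt P) (toℕ-injective (trans toℕ-v′ (≡.sym i≡2k+1))) (begin
    toℕ (mate P v′)             ≡⟨ cong (toℕ ∘ mate P) P-v ⟨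
    toℕ (mate P (mate P v))     ≡⟨ cong toℕ (mate-mate P v) ⟩
    toℕ v                       ≡⟨ toℕ-v ⟩
    k + k                       ≡⟨ sibling-involutive (k + k) ⟨
    sibling (sibling (k + k))   ≡⟨ cong sibling (trans (sibling-double k) (≡.sym toℕ-v′)) ⟩
    sibling (toℕ v′)            ∎)
    where open ≡-Reasoning
  ... | inj₁ i<2k+1 with m<1+n⇒m<n∨m≡n i<2k+1
  ...   | inj₁ i<2k  = std i i<2k
  ...   | inj₂ i≡2k  = subst (StandardAt P) (toℕ-injective (trans toℕ-v (≡.sym i≡2k))) (begin
    toℕ (mate P v)              ≡⟨ cong toℕ P-v ⟩
    toℕ v′                      ≡⟨ trans toℕ-v′ (≡.sym (sibling-double k)) ⟩
    sibling (k + k)             ≡⟨ cong sibling toℕ-v ⟨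
    sibling (toℕ v)             ∎)
    where open ≡-Reasoning

  step-moving : (P : NearPerfectMatching (suc (m + m))) → StandardBelow k P → mate P v ≢ v →
                ∃ λ Q → P ∼ Q × StandardBelow (suc k) Q
  step-moving P std u≢v = swap u v′ P , swap-∼ u v′ P , StandardBelow-suc (swap u v′ P) std′ Q-v
    where
    u : Fin (suc (m + m))
    u = mate P v
    u≮2k : ¬ toℕ u < k + k
    u≮2k u<2k = <-irrefl refl (subst (_< k + k) mate-u≡2k (sibling-< k u<2k))
      where
      mate-u≡2k : sibling (toℕ u) ≡ k + k
      mate-u≡2k = trans (≡.sym (std u u<2k)) (trans (cong toℕ (mate-mate P v)) toℕ-v)
    2k<u : k + k < toℕ u
    2k<u = ≤∧≢⇒< (≮⇒≥ u≮2k) (λ 2k≡u → u≢v (toℕ-injective (trans (≡.sym 2k≡u) (≡.sym toℕ-v))))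
    std′ : StandardBelow k (swap u v′ P)
    std′ = swap-StandardBelow {k = k} {P = P} (<⇒≤ 2k<u) (≤-trans (n≤1+n _) (≤-reflexive (≡.sym toℕ-v′))) std
    Q-v : transpose u v′ (mate P (transpose u v′ v)) ≡ v′
    Q-v = trans (cong (transpose u v′ ∘ mate P) (transpose-≢ (u≢v ∘ ≡.sym) v≢v′)) (transpose-≡ˡ u v′)

  swap-last-moves : (P : NearPerfectMatching (suc (m + m))) → mate P v ≡ v → mate (swap v last P) v ≢ v
  swap-last-moves P v-fixed moved-fixed =
    v≢last (trans (fixed⇒centre P v v-fixed) (≡.sym (fixed⇒centre P last last-fixed)))
    where
    open ≡-Reasoning
    τ : Fin (suc (m + m)) → Fin (suc (m + m))
    τ = transpose v last
    last-fixed : mate P last ≡ last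
    last-fixed = begin
      mate P last                 ≡⟨ transpose-involutive v last _ ⟨
      τ (τ (mate P last))         ≡⟨ cong (λ j → τ (τ (mate P j))) (transpose-≡ˡ v last) ⟨
      τ (mate (swap v last P) v)  ≡⟨ cong τ moved-fixed ⟩
      τ v                         ≡⟨ transpose-≡ˡ v last ⟩
      last                        ∎

  -- If 2k is the centre, the centre is first moved to the last vertex; then transposing
  -- mate 2k with 2k + 1 pairs 2k with 2k + 1 without touching the pairs below 2k.
  step : (P : NearPerfectMatching (suc (m + m))) → StandardBelow k P →
         ∃ λ Q → P ∼ Q × StandardBelow (suc k) Q
  step P std with mate P v ≟ v
  ... | no  v-moved = step-moving P std v-moved
  ... | yes v-fixed = via-swap (step-moving (swap v last P) std′ (swap-last-moves P v-fixed))
    where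
    std′ : StandardBelow k (swap v last P)
    std′ = swap-StandardBelow {k = k} {P = P} (≤-reflexive (≡.sym toℕ-v)) 2k≤last std
    via-swap : (∃ λ Q → swap v last P ∼ Q × StandardBelow (suc k) Q) → ∃ λ Q → P ∼ Q × StandardBelow (suc k) Q
    via-swap (Q , P′∼Q , stdQ) = Q , ∼-trans (swap-∼ v last P) P′∼Q , stdQ

standardise : ∀ {m} k → k ≤ m → (P : NearPerfectMatching (suc (m + m))) → ∃ λ Q → P ∼ Q × StandardBelow k Q
standardise zero    _   P = P , ∼-refl , λ _ ()
standardise (suc k) k<m P with standardise k (<⇒≤ k<m) P
... | Q , P∼Q , stdQ with step k<m Q stdQ
...   | R , Q∼R , stdR = R , ∼-trans P∼Q Q∼R , stdR

module _ {m : ℕ} where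

  private
    ≮⇒top : (i : Fin (suc (m + m))) → ¬ toℕ i < m + m → toℕ i ≡ m + m
    ≮⇒top i i≮2m = ≤-antisym (≤-pred (toℕ<n i)) (≮⇒≥ i≮2m)

  StandardBelow-top-fixed : {P : NearPerfectMatching (suc (m + m))} → StandardBelow m P →
                            ∀ i → ¬ toℕ i < m + m → mate P i ≡ i
  StandardBelow-top-fixed {P} std i i≮2m =
    toℕ-injective (trans (≮⇒top (mate P i) mate≮2m) (≡.sym (≮⇒top i i≮2m)))
    where
    mate≮2m : ¬ toℕ (mate P i) < m + m
    mate≮2m mate<2m = i≮2m (subst (_< m + m) sibling≡i (sibling-< m mate<2m))
      where
      sibling≡i : sibling (toℕ (mate P i)) ≡ toℕ i
      sibling≡i = trans (≡.sym (std _ mate<2m)) (cong toℕ (mate-mate P i))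

  StandardBelow-unique : {P Q : NearPerfectMatching (suc (m + m))} → StandardBelow m P → StandardBelow m Q →
                         ∀ i → mate P i ≡ mate Q i
  StandardBelow-unique {P} {Q} stdP stdQ i with toℕ i <? m + m
  ... | yes i<2m = toℕ-injective (trans (stdP i i<2m) (≡.sym (stdQ i i<2m)))
  ... | no  i≮2m =
    trans (StandardBelow-top-fixed {P} stdP i i≮2m) (≡.sym (StandardBelow-top-fixed {Q} stdQ i i≮2m))

  standardMate : Fin (suc (m + m)) → Fin (suc (m + m))
  standardMate i with toℕ i <? m + m
  ... | yes i<2m = fromℕ< (m<n⇒m<1+n (sibling-< m i<2m))
  ... | no  _    = i

  standardMate-below : ∀ i → toℕ i < m + m → toℕ (standardMate i) ≡ sibling (toℕ i)
  standardMate-below i i<2m with toℕ i <? m + m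
  ... | yes _    = toℕ-fromℕ< _
  ... | no  i≮2m = contradiction i<2m i≮2m

  standardMate-top : ∀ i → ¬ toℕ i < m + m → standardMate i ≡ i
  standardMate-top i i≮2m with toℕ i <? m + m
  ... | yes i<2m = contradiction i<2m i≮2m
  ... | no  _    = refl

  standardMatching : NearPerfectMatching (suc (m + m))
  standardMatching = record
    { mate         = standardMate
    ; mate-mate    = mate-mate′
    ; centre       = fromℕ (m + m)
    ; mate-centre  = standardMate-top _ (<-irrefl (toℕ-fromℕ (m + m)))
    ; fixed⇒centre = fixed⇒centre′
    }
    where
    mate-mate′ : ∀ i → standardMate (standardMate i) ≡ i
    mate-mate′ i with m + m ≤? toℕ i
    ... | yes 2m≤i = trans (cong standardMate (standardMate-top i (≤⇒≯ 2m≤i))) (standardMate-top i (≤⇒≯ 2m≤i))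
    ... | no  2m≰i = toℕ-injective (begin
      toℕ (standardMate (standardMate i))  ≡⟨ standardMate-below _ mate<2m ⟩
      sibling (toℕ (standardMate i))       ≡⟨ cong sibling (standardMate-below i i<2m) ⟩
      sibling (sibling (toℕ i))            ≡⟨ sibling-involutive (toℕ i) ⟩
      toℕ i                                ∎)
      where
      open ≡-Reasoning
      i<2m : toℕ i < m + m
      i<2m = ≰⇒> 2m≰i
      mate<2m : toℕ (standardMate i) < m + m
      mate<2m = subst (_< m + m) (≡.sym (standardMate-below i i<2m)) (sibling-< m i<2m)
    fixed⇒centre′ : ∀ i → standardMate i ≡ i → i ≡ fromℕ (m + m)
    fixed⇒centre′ i fixed with m + m ≤? toℕ i
    ... | yes 2m≤i = toℕ-injective (trans (≮⇒top i (≤⇒≯ 2m≤i)) (≡.sym (toℕ-fromℕ (m + m))))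
    ... | no  2m≰i = contradiction sibling≡i (sibling-≢ (toℕ i))
      where
      sibling≡i : sibling (toℕ i) ≡ toℕ i
      sibling≡i = trans (≡.sym (standardMate-below i (≰⇒> 2m≰i))) (cong toℕ fixed)

  ≡ᵇ-sibling≡≡ᵇ-standardMate : ∀ i j → toℕ j ≢ toℕ i →
                                (toℕ j ≡ᵇ sibling (toℕ i)) ≡ (toℕ j ≡ᵇ toℕ (standardMate i))
  ≡ᵇ-sibling≡≡ᵇ-standardMate i j j≢i with m + m ≤? toℕ i
  ... | no  2m≰i = cong (toℕ j ≡ᵇ_) (≡.sym (standardMate-below i (≰⇒> 2m≰i)))
  ... | yes 2m≤i = trans (≢⇒≡ᵇ-false j≢sibling)
                         (≡.sym (trans (cong (λ k → toℕ j ≡ᵇ toℕ k) i-fixed) (≢⇒≡ᵇ-false j≢i)))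
    where
    i-fixed : standardMate i ≡ i
    i-fixed = standardMate-top i (≤⇒≯ 2m≤i)
    j≢sibling : toℕ j ≢ sibling (toℕ i)
    j≢sibling j≡ = <-irrefl (trans j≡ (trans (cong sibling (≮⇒top i (≤⇒≯ 2m≤i))) (sibling-double m))) (toℕ<n j)

  ∼standardMatching : (P : NearPerfectMatching (suc (m + m))) → P ∼ standardMatching
  ∼standardMatching P with standardise m ≤-refl P
  ... | Q , P∼Q , stdQ = ∼-resp-mate P∼Q (StandardBelow-unique {Q} {standardMatching} stdQ standardMate-below)

/2≡⌊/2⌋ : ∀ x → x / 2 ≡ ⌊ x /2⌋
/2≡⌊/2⌋ zero          = refl
/2≡⌊/2⌋ (suc zero)    = refl
/2≡⌊/2⌋ (suc (suc x)) = trans (m/n≡1+[m∸n]/n {suc (suc x)} {2} (s≤s (s≤s z≤n))) (cong suc (/2≡⌊/2⌋ x))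

⌊/2⌋-≡ᵇ : ∀ x y → x ≢ y → (⌊ x /2⌋ ≡ᵇ ⌊ y /2⌋) ≡ (y ≡ᵇ sibling x)
⌊/2⌋-≡ᵇ zero          zero          x≢y = contradiction refl x≢y
⌊/2⌋-≡ᵇ zero          (suc zero)    _   = refl
⌊/2⌋-≡ᵇ zero          (suc (suc y)) _   = refl
⌊/2⌋-≡ᵇ (suc zero)    zero          _   = refl
⌊/2⌋-≡ᵇ (suc zero)    (suc zero)    x≢y = contradiction refl x≢y
⌊/2⌋-≡ᵇ (suc zero)    (suc (suc y)) _   = refl
⌊/2⌋-≡ᵇ (suc (suc x)) zero          _   = refl
⌊/2⌋-≡ᵇ (suc (suc x)) (suc zero)    _   = refl
⌊/2⌋-≡ᵇ (suc (suc x)) (suc (suc y)) x≢y = ⌊/2⌋-≡ᵇ x y (x≢y ∘ cong (suc ∘ suc))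

co-coM-matching : ∀ m → IsMatchingGraph (standardMatching {m}) (co (coM (suc (m + m))))
co-coM-matching m i j with i =ᵥ j in i=j
... | true  = refl
... | false = begin
  not (not (toℕ i / 2 ≡ᵇ toℕ j / 2))     ≡⟨ Bool.not-involutive _ ⟩
  toℕ i / 2 ≡ᵇ toℕ j / 2                 ≡⟨ cong₂ _≡ᵇ_ (/2≡⌊/2⌋ (toℕ i)) (/2≡⌊/2⌋ (toℕ j)) ⟩
  ⌊ toℕ i /2⌋ ≡ᵇ ⌊ toℕ j /2⌋             ≡⟨ ⌊/2⌋-≡ᵇ (toℕ i) (toℕ j) i≢j ⟩
  toℕ j ≡ᵇ sibling (toℕ i)               ≡⟨ ≡ᵇ-sibling≡≡ᵇ-standardMate {m} i j (i≢j ∘ ≡.sym) ⟩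
  toℕ j ≡ᵇ toℕ (standardMate {m} i)      ∎
  where
  open ≡-Reasoning
  i≢j : toℕ i ≢ toℕ j
  i≢j i≡j = contradiction (trans (≡.sym i=j) (subst (λ y → (toℕ i ≡ᵇ y) ≡ true) i≡j (≡ᵇ-refl (toℕ i))))
                          λ ()

coM-N-AW : ∀ m ℓ .{{_ : NonZero ℓ}} → N-AW ℓ (coM (suc (m + m)))
coM-N-AW m = complement-of-matching-N-AW (standardMatching {m}) (coM (suc (m + m))) (co-coM-matching m)

edges-coM : ∀ m → edges (coM (suc (m + m))) ≡ suc (m + m) C 2 ∸ m
edges-coM m = trans (edges≡C2∸edges-co (coM (suc (m + m)))) (cong (suc (m + m) C 2 ∸_) edges-H≡m)
  where
  open ≡-Reasoning
  H : Graph (suc (m + m))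
  H = co (coM (suc (m + m)))
  edges-H≡m : edges H ≡ m
  edges-H≡m = double-injective (suc-injective (begin
    suc (edges H + edges H)  ≡⟨ cong suc (handshake H) ⟨
    1 + sum (deg H)          ≡⟨ 1+Σdeg-matching {P = standardMatching {m}} {H = H} (co-coM-matching m) ⟩
    suc (m + m)              ∎))

module _ {m ℓ : ℕ} .{{_ : NonZero ℓ}} (2≤ℓ : 2 ≤ ℓ) (G : Graph (suc (m + m))) (aw : N-AW ℓ G) where

  private
    isolated-unique : ∀ {u v} → deg (co G) u ≡ 0 → deg (co G) v ≡ 0 → u ≡ v
    isolated-unique = N-AW⇒co-isolated-unique 2≤ℓ G aw

  m≤edges-co : m ≤ edges (co G)
  m≤edges-co = double-cancel-≤ (≤-pred (begin
    suc (m + m)                        ≤⟨ n≤1+Σdeg (co G) isolated-unique ⟩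
    1 + sum (deg (co G))               ≡⟨ cong suc (handshake (co G)) ⟩
    suc (edges (co G) + edges (co G))  ∎))
    where open ≤-Reasoning

  N-AW⇒edges≤ : edges G ≤ suc (m + m) C 2 ∸ m
  N-AW⇒edges≤ = subst (_≤ suc (m + m) C 2 ∸ m) (≡.sym (edges≡C2∸edges-co G)) (∸-monoʳ-≤ _ m≤edges-co)

  edges-co≡m⇒≅coM : edges (co G) ≡ m → G ≅ coM (suc (m + m))
  edges-co≡m⇒≅coM e≡m = from-matching-like (n≡1+Σdeg⇒deg≤1×isolated (co G) isolated-unique n≡1+Σdeg)
    where
    n≡1+Σdeg : suc (m + m) ≡ 1 + sum (deg (co G))
    n≡1+Σdeg = cong suc (trans (cong (λ k → k + k) (≡.sym e≡m)) (≡.sym (handshake (co G))))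
    from-matching-like : (∀ i → deg (co G) i ≤ 1) × (∃ λ w → deg (co G) w ≡ 0) → G ≅ coM (suc (m + m))
    from-matching-like (deg≤1 , w , w-isolated) =
      co-matching-∼⇒≅ {P = P} {standardMatching {m}} {G} {coM (suc (m + m))}
        (adj≡mateOf (co G) deg≤1) (co-coM-matching m) (∼standardMatching {m} P)
      where
      P : NearPerfectMatching (suc (m + m))
      P = matchingOf (co G) deg≤1 w w-isolated (λ i i-isolated → isolated-unique i-isolated w-isolated)

  N-AW-extremal⇒≅coM : edges G ≡ suc (m + m) C 2 ∸ m → G ≅ coM (suc (m + m))
  N-AW-extremal⇒≅coM edges≡ = edges-co≡m⇒≅coM (∸-cancelˡ-≡ (edges-co≤C2 G) m≤C2 C2∸e≡C2∸m)
    where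
    m≤C2 : m ≤ suc (m + m) C 2
    m≤C2 = ≤-trans m≤edges-co (edges-co≤C2 G)
    C2∸e≡C2∸m : suc (m + m) C 2 ∸ edges (co G) ≡ suc (m + m) C 2 ∸ m
    C2∸e≡C2∸m = trans (≡.sym (edges≡C2∸edges-co G)) edges≡

odd⇒≡1+2[n/2] : ∀ n → n % 2 ≡ 1 → n ≡ suc (n / 2 + n / 2)
odd⇒≡1+2[n/2] n odd = begin
  n                     ≡⟨ m≡m%n+[m/n]*n n 2 ⟩
  n % 2 + n / 2 * 2     ≡⟨ cong₂ _+_ odd (trans (*-comm (n / 2) 2) (≡.sym (double≡2* (n / 2)))) ⟩
  suc (n / 2 + n / 2)   ∎
  where open ≡-Reasoning

proposition4p2 : (n : ℕ) → n % 2 ≡ 1 → (ℓ : ℕ) → .{{_ : NonZero ℓ}} → 2 ≤ ℓ →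
    (N-AW ℓ (coM n) × edges (coM n) ≡ n C 2 ∸ n / 2)
    × (∀ (G : Graph n) → N-AW ℓ G → edges G ≤ n C 2 ∸ n / 2)
    × (∀ (G : Graph n) → N-AW ℓ G → edges G ≡ n C 2 ∸ n / 2 → G ≅ coM n)
proposition4p2 n odd ℓ 2≤ℓ = extremal (n / 2) (odd⇒≡1+2[n/2] n odd)
  where
  extremal : ∀ m → n ≡ suc (m + m) →
    (N-AW ℓ (coM n) × edges (coM n) ≡ n C 2 ∸ m)
    × (∀ (G : Graph n) → N-AW ℓ G → edges G ≤ n C 2 ∸ m)
    × (∀ (G : Graph n) → N-AW ℓ G → edges G ≡ n C 2 ∸ m → G ≅ coM n)
  extremal m refl = (coM-N-AW m ℓ , edges-coM m) , N-AW⇒edges≤ {m} 2≤ℓ , N-AW-extremal⇒≅coM {m} 2≤ℓ
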